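{- Let $m\ge1$. For every integer $q\ge1$ and every $n\ge0$, $$\sum_{k=0}^n(-1)^k\frac{1}{m^{k+1}}f_{n,k}=1,$$ where $f_{n,k}$ is the number of $k$-dimensional faces of $\Delta^{(n)}_{m,q}$. Equivalently, $\sum_{k=0}^n(-1)^km^{n-k}f_{n,k}=m^{n+1}$.
   Context: $[k]$ is the $0$-dimensional simplicial complex with $k$ vertices; the join is $\mathcal F*\mathcal K=\{\sigma\cup\tau:\sigma\in\mathcal F\cup\{\emptyset\},\tau\in\mathcal K\cup\{\emptyset\}\}$ on disjoint vertex sets; $\Delta^{(0)}_{m,q}=[m]$ and $\Delta^{(n)}_{m,q}=\Delta^{(n-1)}_{m,q}*[q]$ for $n\ge1$. -}

module Defs where

open import Data.Nat using (ℕ; zero; suc; _+_; _∸_; _≡ᵇ_)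
open import Data.Bool using (Bool; true; false; _∧_; _∨_)
open import Data.Vec using (Vec; []; _∷_; take; drop)
open import Data.List using (List; []; _∷_; map; _++_; filter; length; upTo; foldr)
open import Data.Fin.Subset using (Subset; ∣_∣)
open import Data.Integer as ℤ using (ℤ; +_; -_)
open import Relation.Nullary.Decidable using (yes; no)
open import Data.Bool using (T?)

-- A (finite, abstract) simplicial complex on the vertex set Fin N, given by its
-- decidable family of faces: a face is a subset of the vertices.
Complex : ℕ → Set
Complex N = Subset N → Bool

point : (k : ℕ) → Complex k
point k σ = ∣ σ ∣ ≡ᵇ 1

orEmpty : ∀ {N} → Complex N → Complex N
orEmpty K σ = K σ ∨ (∣ σ ∣ ≡ᵇ 0)

-- Join on disjoint vertex sets Fin a and Fin b (vertex set Fin (a + b)):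
-- F * K = { σ ∪ τ : σ ∈ F ∪ {∅}, τ ∈ K ∪ {∅} }.
-- A subset of Fin (a + b) decomposes uniquely as σ ∪ τ with σ ⊆ Fin a, τ ⊆ Fin b.
join : ∀ {a b} → Complex a → Complex b → Complex (a + b)
join {a} F K σ = orEmpty F (take a σ) ∧ orEmpty K (drop a σ)

V : ℕ → ℕ → ℕ → ℕ
V m q zero = m
V m q (suc n) = V m q n + q

Δ : (m q n : ℕ) → Complex (V m q n)
Δ m q zero = point m
Δ m q (suc n) = join (Δ m q n) (point q)

allSubsets : (N : ℕ) → List (Subset N)
allSubsets zero = [] ∷ []
allSubsets (suc N) = map (false ∷_) (allSubsets N) ++ map (true ∷_) (allSubsets N)

faceCount : ∀ {N} → Complex N → ℕ → ℕ
faceCount {N} K k = length (filter (λ σ → T? (K σ ∧ (∣ σ ∣ ≡ᵇ suc k))) (allSubsets N))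

f : (m q n k : ℕ) → ℕ
f m q n k = faceCount (Δ m q n) k

sumTo : ℕ → (ℕ → ℤ) → ℤ
sumTo n g = foldr (λ k acc → g k ℤ.+ acc) (+ 0) (upTo (suc n))

{-# OPTIONS --safe #-}
-- Joining with [q] gives f_{n+1,k} = f_{n,k} + q f_{n,k-1}, where f_{n,-1} = 1 counts the empty face:
-- a face of the join is a possibly empty face of Δ^(n) plus at most one of the q new vertices.
-- Put A_n(c) = Σ_{k≤n} (-1)^k m^{n-k} c_k.  Since f_{n,n+1} = 0, A_{n+1}(f_{n,·}) = m A_n(f_{n,·}), and
-- shifting the index gives A_{n+1}(f_{n,·-1}) = m^{n+1} - A_n(f_{n,·}).  So by induction A_{n+1}(f_{n+1,·})
-- = m·m^{n+1} + q (m^{n+1} - m^{n+1}) = m^{n+2}.  In other words, the face polynomial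
-- Σ_k f_{n,k-1} t^k = (1 + m t)(1 + q t)^n vanishes at t = -1/m.
module Submission where

open import Defs
open import Data.Nat using (ℕ; _≥_; _∸_; _^_; suc)
open import Data.Integer as ℤ using (ℤ; +_; -_)
open import Relation.Binary.PropositionalEquality using (_≡_; trans)

module FaceCounts where
  open import Data.Nat using (zero; _+_; _*_; _<_; _≡ᵇ_; s≤s)
  open import Data.Nat.Properties
    using (+-assoc; +-comm; +-identityʳ; *-identityʳ; *-zeroʳ; *-distribˡ-+; m≤n⇒m≤1+n; +-commutativeSemigroup)
  open import Algebra.Properties.CommutativeSemigroup +-commutativeSemigroup using (interchange)
  open import Data.Bool using (Bool; true; false; _∧_; _∨_; T?)
  open import Data.Bool.Properties using (∧-idem; ∨-identityʳ; ∧-commutativeMonoid)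
  open import Algebra.Bundles using (CommutativeMonoid)
  open import Algebra.Properties.CommutativeSemigroup (CommutativeMonoid.commutativeSemigroup ∧-commutativeMonoid)
    using (xy∙z≈y∙xz)
  open import Data.Vec using (Vec; _∷_; []; take; drop; _++_)
  open import Data.Vec.Properties using (++-injective; take++drop≡id)
  open import Data.List as List using (List; filter; length)
  open import Data.List.Properties using (filter-++; length-++; length-map)
  open import Data.Fin.Subset using (Subset; ∣_∣)
  open import Data.Product using (_×_; proj₁; proj₂)
  open import Function using (_∘_)
  open import Relation.Nullary using (does)
  open import Relation.Unary using (Decidable)
  open import Relation.Binary.PropositionalEquality using (_≡_; refl; sym; trans; cong; cong₂; _≗_; module ≡-Reasoning)

  indicator : Bool → ℕ
  indicator true  = 1
  indicator false = 0

  indicator-∧ : ∀ a b → indicator (a ∧ b) ≡ indicator a * indicator b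
  indicator-∧ true  b = sym (+-identityʳ (indicator b))
  indicator-∧ false b = refl

  filter-map : ∀ {A B : Set} {P : B → Set} (P? : Decidable P) (g : A → B) (xs : List A) →
               filter P? (List.map g xs) ≡ List.map g (filter (P? ∘ g) xs)
  filter-map P? g List.[] = refl
  filter-map P? g (x List.∷ xs) with does (P? (g x))
  ... | true  = cong (g x List.∷_) (filter-map P? g xs)
  ... | false = filter-map P? g xs

  sumSubsets : (N : ℕ) → (Subset N → ℕ) → ℕ
  sumSubsets zero    h = h []
  sumSubsets (suc N) h = sumSubsets N (h ∘ (false ∷_)) + sumSubsets N (h ∘ (true ∷_))

  length-filter-allSubsets : ∀ N (P : Subset N → Bool) →
    length (filter (T? ∘ P) (allSubsets N)) ≡ sumSubsets N (indicator ∘ P)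
  length-filter-allSubsets zero P with P []
  ... | true  = refl
  ... | false = refl
  length-filter-allSubsets (suc N) P = begin
    length (filter (T? ∘ P) (List.map (false ∷_) S List.++ List.map (true ∷_) S))
      ≡⟨ cong length (filter-++ (T? ∘ P) (List.map (false ∷_) S) _) ⟩
    length (filter (T? ∘ P) (List.map (false ∷_) S) List.++ filter (T? ∘ P) (List.map (true ∷_) S))
      ≡⟨ length-++ (filter (T? ∘ P) (List.map (false ∷_) S)) ⟩
    length (filter (T? ∘ P) (List.map (false ∷_) S)) + length (filter (T? ∘ P) (List.map (true ∷_) S))
      ≡⟨ cong₂ _+_ (countBranch false) (countBranch true) ⟩
    sumSubsets (suc N) (indicator ∘ P) ∎
    where
    open ≡-Reasoning
    S : List (Subset N)
    S = allSubsets N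
    countBranch : ∀ b → length (filter (T? ∘ P) (List.map (b ∷_) S)) ≡ sumSubsets N (indicator ∘ P ∘ (b ∷_))
    countBranch b = begin
      length (filter (T? ∘ P) (List.map (b ∷_) S))     ≡⟨ cong length (filter-map (T? ∘ P) (b ∷_) S) ⟩
      length (List.map (b ∷_) (filter (T? ∘ P ∘ (b ∷_)) S)) ≡⟨ length-map (b ∷_) (filter (T? ∘ P ∘ (b ∷_)) S) ⟩
      length (filter (T? ∘ P ∘ (b ∷_)) S)               ≡⟨ length-filter-allSubsets N (P ∘ (b ∷_)) ⟩
      sumSubsets N (indicator ∘ P ∘ (b ∷_))              ∎

  sumSubsets-cong : ∀ N {g h : Subset N → ℕ} → g ≗ h → sumSubsets N g ≡ sumSubsets N h
  sumSubsets-cong zero    g≗h = g≗h []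
  sumSubsets-cong (suc N) g≗h =
    cong₂ _+_ (sumSubsets-cong N (g≗h ∘ (false ∷_))) (sumSubsets-cong N (g≗h ∘ (true ∷_)))

  sumSubsets-zero : ∀ N → sumSubsets N (λ _ → 0) ≡ 0
  sumSubsets-zero zero    = refl
  sumSubsets-zero (suc N) = cong₂ _+_ (sumSubsets-zero N) (sumSubsets-zero N)

  sumSubsets-+ : ∀ N (g h : Subset N → ℕ) →
    sumSubsets N (λ σ → g σ + h σ) ≡ sumSubsets N g + sumSubsets N h
  sumSubsets-+ zero    g h = refl
  sumSubsets-+ (suc N) g h =
    trans (cong₂ _+_ (sumSubsets-+ N g₀ h₀) (sumSubsets-+ N g₁ h₁))
          (interchange (sumSubsets N g₀) (sumSubsets N h₀) (sumSubsets N g₁) (sumSubsets N h₁))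
    where
    g₀ h₀ g₁ h₁ : Subset N → ℕ
    g₀ = g ∘ (false ∷_)
    h₀ = h ∘ (false ∷_)
    g₁ = g ∘ (true ∷_)
    h₁ = h ∘ (true ∷_)

  sumSubsets-* : ∀ N c (g : Subset N → ℕ) → sumSubsets N (λ σ → c * g σ) ≡ c * sumSubsets N g
  sumSubsets-* zero    c g = refl
  sumSubsets-* (suc N) c g =
    trans (cong₂ _+_ (sumSubsets-* N c _) (sumSubsets-* N c _)) (sym (*-distribˡ-+ c _ _))

  sumSubsets-++ : ∀ a b (h : Subset (a + b) → ℕ) →
    sumSubsets (a + b) h ≡ sumSubsets a (λ σ → sumSubsets b (λ τ → h (σ ++ τ)))
  sumSubsets-++ zero    b h = refl
  sumSubsets-++ (suc a) b h = cong₂ _+_ (sumSubsets-++ a b _) (sumSubsets-++ a b _)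

  sumSubsets-empty : ∀ N (g : ℕ → ℕ) → sumSubsets N (λ σ → indicator (∣ σ ∣ ≡ᵇ 0) * g ∣ σ ∣) ≡ g 0
  sumSubsets-empty zero    g = +-identityʳ (g 0)
  sumSubsets-empty (suc N) g = trans (cong₂ _+_ (sumSubsets-empty N g) (sumSubsets-zero N)) (+-identityʳ (g 0))

  countEmpty : ∀ N → sumSubsets N (λ σ → indicator (∣ σ ∣ ≡ᵇ 0)) ≡ 1
  countEmpty N = trans (sumSubsets-cong N (λ σ → sym (*-identityʳ _))) (sumSubsets-empty N (λ _ → 1))

  countSingletons : ∀ N → sumSubsets N (λ σ → indicator (∣ σ ∣ ≡ᵇ 1)) ≡ N
  countSingletons zero    = refl
  countSingletons (suc N) = trans (cong₂ _+_ (countSingletons N) (countEmpty N)) (+-comm N 1)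

  sumSubsets-pointOrEmpty : ∀ q (g : ℕ → ℕ) →
    sumSubsets q (λ τ → indicator (orEmpty (point q) τ) * g ∣ τ ∣) ≡ g 0 + q * g 1
  sumSubsets-pointOrEmpty zero    g = refl
  sumSubsets-pointOrEmpty (suc q) g = begin
    sumSubsets q (λ τ → indicator (orEmpty (point q) τ) * g ∣ τ ∣)
      + sumSubsets q (λ τ → indicator ((∣ τ ∣ ≡ᵇ 0) ∨ false) * g (suc ∣ τ ∣))
      ≡⟨ cong₂ _+_ (sumSubsets-pointOrEmpty q g) (trans
           (sumSubsets-cong q (λ τ → cong (λ b → indicator b * g (suc ∣ τ ∣)) (∨-identityʳ (∣ τ ∣ ≡ᵇ 0))))
           (sumSubsets-empty q (g ∘ suc))) ⟩
    g 0 + q * g 1 + g 1  ≡⟨ +-assoc (g 0) (q * g 1) (g 1) ⟩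
    g 0 + (q * g 1 + g 1) ≡⟨ cong (_+_ (g 0)) (+-comm (q * g 1) (g 1)) ⟩
    g 0 + suc q * g 1     ∎
    where open ≡-Reasoning

  take-drop-++ : ∀ {A : Set} {a b} (σ : Vec A a) (τ : Vec A b) → take a (σ ++ τ) ≡ σ × drop a (σ ++ τ) ≡ τ
  take-drop-++ {a = a} σ τ = ++-injective (take a (σ ++ τ)) σ (take++drop≡id a (σ ++ τ))

  ∣p++q∣≡∣p∣+∣q∣ : ∀ {a b} (σ : Subset a) (τ : Subset b) → ∣ σ ++ τ ∣ ≡ ∣ σ ∣ + ∣ τ ∣
  ∣p++q∣≡∣p∣+∣q∣ []          τ = refl
  ∣p++q∣≡∣p∣+∣q∣ (false ∷ σ) τ = ∣p++q∣≡∣p∣+∣q∣ σ τ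
  ∣p++q∣≡∣p∣+∣q∣ (true  ∷ σ) τ = cong suc (∣p++q∣≡∣p∣+∣q∣ σ τ)

  faceCountBySize : ∀ {N} → Complex N → ℕ → ℕ
  faceCountBySize {N} K s = sumSubsets N (λ σ → indicator (K σ ∧ (∣ σ ∣ ≡ᵇ s)))

  faceCount-bySize : ∀ {N} (K : Complex N) k → faceCount K k ≡ faceCountBySize K (suc k)
  faceCount-bySize {N} K k = length-filter-allSubsets N (λ σ → K σ ∧ (∣ σ ∣ ≡ᵇ suc k))

  augmentedFaceCount : ∀ {N} → Complex N → ℕ → ℕ
  augmentedFaceCount K zero    = 1
  augmentedFaceCount K (suc k) = faceCount K k

  bySize-orEmpty : ∀ {N} (K : Complex N) s → faceCountBySize (orEmpty K) s ≡ augmentedFaceCount K s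
  bySize-orEmpty {N} K zero = trans (sumSubsets-cong N (cong indicator ∘ emptyOnly)) (countEmpty N)
    where
    emptyOnly : ∀ σ → (K σ ∨ (∣ σ ∣ ≡ᵇ 0)) ∧ (∣ σ ∣ ≡ᵇ 0) ≡ (∣ σ ∣ ≡ᵇ 0)
    emptyOnly σ with K σ
    ... | true  = refl
    ... | false = ∧-idem (∣ σ ∣ ≡ᵇ 0)
  bySize-orEmpty {N} K (suc k) =
    trans (sumSubsets-cong N (λ σ → cong indicator (nonEmpty (K σ) ∣ σ ∣))) (sym (faceCount-bySize K k))
    where
    nonEmpty : ∀ b x → (b ∨ (x ≡ᵇ 0)) ∧ (x ≡ᵇ suc k) ≡ b ∧ (x ≡ᵇ suc k)
    nonEmpty true  x       = refl
    nonEmpty false zero    = refl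
    nonEmpty false (suc x) = refl

  faceCount-join-point : ∀ {a} (F : Complex a) q k →
    faceCount (join F (point q)) k ≡ faceCount F k + q * augmentedFaceCount F k
  faceCount-join-point {a} F q k = begin
    faceCount (join F (point q)) k
      ≡⟨ faceCount-bySize (join F (point q)) k ⟩
    sumSubsets (a + q) (λ ρ → indicator (join F (point q) ρ ∧ (∣ ρ ∣ ≡ᵇ suc k)))
      ≡⟨ sumSubsets-++ a q _ ⟩
    sumSubsets a (λ σ → sumSubsets q (λ τ → indicator (join F (point q) (σ ++ τ) ∧ (∣ σ ++ τ ∣ ≡ᵇ suc k))))
      ≡⟨ sumSubsets-cong a (λ σ → trans (sumSubsets-cong q (splitFace σ)) (sumSubsets-pointOrEmpty q (sizeWeight σ))) ⟩
    sumSubsets a (λ σ → sizeWeight σ 0 + q * sizeWeight σ 1)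
      ≡⟨ sumSubsets-+ a (λ σ → sizeWeight σ 0) (λ σ → q * sizeWeight σ 1) ⟩
    faceCountBySize (orEmpty F) (suc k) + sumSubsets a (λ σ → q * sizeWeight σ 1)
      ≡⟨ cong₂ _+_ (bySize-orEmpty F (suc k)) (sumSubsets-* a q (λ σ → sizeWeight σ 1)) ⟩
    faceCount F k + q * faceCountBySize (orEmpty F) k
      ≡⟨ cong (λ x → faceCount F k + q * x) (bySize-orEmpty F k) ⟩
    faceCount F k + q * augmentedFaceCount F k ∎
    where
    open ≡-Reasoning
    -- j + ∣ σ ∣ rather than ∣ σ ∣ + j, so that j = 0, 1 reduce to the tests ∣ σ ∣ ≡ᵇ suc k and ∣ σ ∣ ≡ᵇ k.
    sizeWeight : Subset a → ℕ → ℕ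
    sizeWeight σ j = indicator (orEmpty F σ ∧ (j + ∣ σ ∣ ≡ᵇ suc k))

    splitFace : ∀ σ τ → indicator (join F (point q) (σ ++ τ) ∧ (∣ σ ++ τ ∣ ≡ᵇ suc k))
                      ≡ indicator (orEmpty (point q) τ) * sizeWeight σ ∣ τ ∣
    splitFace σ τ
      rewrite proj₁ (take-drop-++ σ τ) | proj₂ (take-drop-++ σ τ) | ∣p++q∣≡∣p∣+∣q∣ σ τ | +-comm ∣ σ ∣ ∣ τ ∣ =
      trans (cong indicator (xy∙z≈y∙xz (orEmpty F σ) (orEmpty (point q) τ) (∣ τ ∣ + ∣ σ ∣ ≡ᵇ suc k)))
            (indicator-∧ (orEmpty (point q) τ) (orEmpty F σ ∧ (∣ τ ∣ + ∣ σ ∣ ≡ᵇ suc k)))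

  faceCount-point-vertices : ∀ m → faceCount (point m) 0 ≡ m
  faceCount-point-vertices m = begin
    faceCount (point m) 0                                ≡⟨ faceCount-bySize (point m) 0 ⟩
    sumSubsets m (λ σ → indicator (point m σ ∧ point m σ)) ≡⟨ sumSubsets-cong m (cong indicator ∘ ∧-idem ∘ point m) ⟩
    sumSubsets m (λ σ → indicator (∣ σ ∣ ≡ᵇ 1))            ≡⟨ countSingletons m ⟩
    m                                                    ∎
    where open ≡-Reasoning

  faceCount-point-suc : ∀ m k → faceCount (point m) (suc k) ≡ 0
  faceCount-point-suc m k = trans (faceCount-bySize (point m) (suc k))
    (trans (sumSubsets-cong m (cong indicator ∘ noEdges ∘ ∣_∣)) (sumSubsets-zero m))
    where
    noEdges : ∀ x → (x ≡ᵇ 1) ∧ (x ≡ᵇ suc (suc k)) ≡ false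
    noEdges zero          = refl
    noEdges (suc zero)    = refl
    noEdges (suc (suc x)) = refl

  f-vanishes : ∀ m q {n k} → n < k → f m q n k ≡ 0
  f-vanishes m q {zero}  {suc k} _         = faceCount-point-suc m k
  f-vanishes m q {suc n} {suc k} (s≤s n<k) = begin
    f m q (suc n) (suc k)            ≡⟨ faceCount-join-point (Δ m q n) q (suc k) ⟩
    f m q n (suc k) + q * f m q n k
      ≡⟨ cong₂ (λ x y → x + q * y) (f-vanishes m q (m≤n⇒m≤1+n n<k)) (f-vanishes m q n<k) ⟩
    q * 0                            ≡⟨ *-zeroʳ q ⟩
    0                                ∎
    where open ≡-Reasoning

open FaceCounts

module AlternatingSums where
  open import Data.Nat as ℕ using (zero)
  import Data.Nat.Properties as ℕ
  open import Data.Integer using (_+_; _*_; _-_; -1ℤ; 1ℤ)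
  open import Data.Integer.Properties
    using (+-*-semiring; *-commutativeSemigroup; *-assoc; *-identityˡ; *-zeroʳ; +-identityʳ; pos-+; pos-*; -1*i≡-i)
  open import Data.Integer.Tactic.RingSolver using (solve-∀)
  open import Algebra.Properties.CommutativeSemigroup *-commutativeSemigroup using (x∙yz≈y∙xz)
  open import Algebra.Properties.Semiring.Sum +-*-semiring
    using (sum-syntax; sum⁺-syntax; ∑-distrib-+; *-distribˡ-sum; sum-init-last; sum-cong-≗)
  open import Data.Fin using (toℕ; inject₁; fromℕ)
  open import Data.Fin.Properties using (toℕ-inject₁; toℕ-fromℕ; toℕ≤pred[n])
  open import Data.List using (foldr; applyUpTo)
  open import Function using (_∘_)
  open import Relation.Binary.PropositionalEquality using (refl; sym; trans; cong; cong₂; module ≡-Reasoning)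

  foldr-applyUpTo-∑ : ∀ (g : ℕ → ℤ) (h : ℕ → ℕ) n →
    foldr (λ k acc → g k + acc) (+ 0) (applyUpTo h n) ≡ ∑[ i < n ] g (h (toℕ i))
  foldr-applyUpTo-∑ g h zero    = refl
  foldr-applyUpTo-∑ g h (suc n) = cong (λ s → g (h 0) + s) (foldr-applyUpTo-∑ g (h ∘ suc) n)

  sumTo-∑ : ∀ n g → sumTo n g ≡ ∑[ k ≤ n ] g (toℕ k)
  sumTo-∑ n g = foldr-applyUpTo-∑ g (λ k → k) (suc n)

  module _ (m : ℕ) where
    alternatingTerm : ℕ → (ℕ → ℕ) → ℕ → ℤ
    alternatingTerm n c k = (-1ℤ ℤ.^ k) * (+ (m ^ (n ∸ k)) * + c k)

    alternatingSum : ℕ → (ℕ → ℕ) → ℤ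
    alternatingSum n c = ∑[ k ≤ n ] alternatingTerm n c (toℕ k)

    alternatingSum-linear : ∀ n q {a b c : ℕ → ℕ} → (∀ k → c k ≡ a k ℕ.+ q ℕ.* b k) →
      alternatingSum n c ≡ alternatingSum n a + + q * alternatingSum n b
    alternatingSum-linear n q {a} {b} {c} c≡a+qb = begin
      alternatingSum n c
        ≡⟨ sum-cong-≗ {suc n} (termLinear ∘ toℕ) ⟩
      ∑[ k ≤ n ] (alternatingTerm n a (toℕ k) + + q * alternatingTerm n b (toℕ k))
        ≡⟨ ∑-distrib-+ {suc n} (alternatingTerm n a ∘ toℕ) (λ k → + q * alternatingTerm n b (toℕ k)) ⟩
      alternatingSum n a + ∑[ k ≤ n ] (+ q * alternatingTerm n b (toℕ k))
        ≡⟨ cong (_+_ (alternatingSum n a)) (sym (*-distribˡ-sum {suc n} (+ q) (alternatingTerm n b ∘ toℕ))) ⟩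
      alternatingSum n a + + q * alternatingSum n b ∎
      where
      open ≡-Reasoning
      distrib : ∀ s M A Q B → s * (M * (A + Q * B)) ≡ s * (M * A) + Q * (s * (M * B))
      distrib = solve-∀
      termLinear : ∀ k → alternatingTerm n c k ≡ alternatingTerm n a k + + q * alternatingTerm n b k
      termLinear k = begin
        (-1ℤ ℤ.^ k) * (+ (m ^ (n ∸ k)) * + c k)
          ≡⟨ cong (λ x → (-1ℤ ℤ.^ k) * (+ (m ^ (n ∸ k)) * x))
               (trans (cong +_ (c≡a+qb k)) (trans (pos-+ (a k) _) (cong (_+_ (+ a k)) (pos-* q (b k))))) ⟩
        (-1ℤ ℤ.^ k) * (+ (m ^ (n ∸ k)) * (+ a k + + q * + b k))
          ≡⟨ distrib (-1ℤ ℤ.^ k) (+ (m ^ (n ∸ k))) (+ a k) (+ q) (+ b k) ⟩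
        alternatingTerm n a k + + q * alternatingTerm n b k ∎

    alternatingSum-suc-of-top≡0 : ∀ n (c : ℕ → ℕ) → c (suc n) ≡ 0 →
      alternatingSum (suc n) c ≡ + m * alternatingSum n c
    alternatingSum-suc-of-top≡0 n c top≡0 = begin
      alternatingSum (suc n) c
        ≡⟨ sum-init-last {suc n} (alternatingTerm (suc n) c ∘ toℕ) ⟩
      ∑[ k ≤ n ] alternatingTerm (suc n) c (toℕ (inject₁ k)) + alternatingTerm (suc n) c (toℕ (fromℕ (suc n)))
        ≡⟨ cong₂ _+_ (sum-cong-≗ {suc n} lowerTerm) (trans (cong (alternatingTerm (suc n) c) (toℕ-fromℕ (suc n))) topTerm≡0) ⟩
      ∑[ k ≤ n ] (+ m * alternatingTerm n c (toℕ k)) + + 0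
        ≡⟨ +-identityʳ _ ⟩
      ∑[ k ≤ n ] (+ m * alternatingTerm n c (toℕ k))
        ≡⟨ sym (*-distribˡ-sum {suc n} (+ m) (alternatingTerm n c ∘ toℕ)) ⟩
      + m * alternatingSum n c ∎
      where
      open ≡-Reasoning
      scaleTerm : ∀ k → k ℕ.≤ n → alternatingTerm (suc n) c k ≡ + m * alternatingTerm n c k
      scaleTerm k k≤n = begin
        (-1ℤ ℤ.^ k) * (+ (m ^ (suc n ∸ k)) * + c k)
          ≡⟨ cong (λ e → (-1ℤ ℤ.^ k) * (+ (m ^ e) * + c k)) (ℕ.+-∸-assoc 1 k≤n) ⟩
        (-1ℤ ℤ.^ k) * (+ (m ℕ.* m ^ (n ∸ k)) * + c k)
          ≡⟨ cong (λ x → (-1ℤ ℤ.^ k) * (x * + c k)) (pos-* m (m ^ (n ∸ k))) ⟩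
        (-1ℤ ℤ.^ k) * (+ m * + (m ^ (n ∸ k)) * + c k)
          ≡⟨ cong ((-1ℤ ℤ.^ k) *_) (*-assoc (+ m) _ (+ c k)) ⟩
        (-1ℤ ℤ.^ k) * (+ m * (+ (m ^ (n ∸ k)) * + c k))
          ≡⟨ x∙yz≈y∙xz (-1ℤ ℤ.^ k) (+ m) _ ⟩
        + m * alternatingTerm n c k ∎
      lowerTerm : ∀ k → alternatingTerm (suc n) c (toℕ (inject₁ k)) ≡ + m * alternatingTerm n c (toℕ k)
      lowerTerm k = trans (cong (alternatingTerm (suc n) c) (toℕ-inject₁ k)) (scaleTerm (toℕ k) (toℕ≤pred[n] k))
      topTerm≡0 : alternatingTerm (suc n) c (suc n) ≡ + 0
      topTerm≡0 = begin
        alternatingTerm (suc n) c (suc n)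
          ≡⟨ cong (λ x → (-1ℤ ℤ.^ suc n) * (+ (m ^ (n ∸ n)) * + x)) top≡0 ⟩
        (-1ℤ ℤ.^ suc n) * (+ (m ^ (n ∸ n)) * + 0)
          ≡⟨ cong ((-1ℤ ℤ.^ suc n) *_) (*-zeroʳ (+ (m ^ (n ∸ n)))) ⟩
        (-1ℤ ℤ.^ suc n) * + 0
          ≡⟨ *-zeroʳ (-1ℤ ℤ.^ suc n) ⟩
        + 0 ∎

    alternatingSum-suc-shift : ∀ n (c : ℕ → ℕ) →
      alternatingSum (suc n) c ≡ + (m ^ suc n) * + c 0 - alternatingSum n (c ∘ suc)
    alternatingSum-suc-shift n c = cong₂ _+_ (*-identityˡ (+ (m ^ suc n) * + c 0)) (begin
      ∑[ k ≤ n ] alternatingTerm (suc n) c (suc (toℕ k))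
        ≡⟨ sum-cong-≗ {suc n} (λ k → *-assoc -1ℤ (-1ℤ ℤ.^ toℕ k) (+ (m ^ (n ∸ toℕ k)) * + c (suc (toℕ k)))) ⟩
      ∑[ k ≤ n ] (-1ℤ * alternatingTerm n (c ∘ suc) (toℕ k))
        ≡⟨ sym (*-distribˡ-sum {suc n} -1ℤ (alternatingTerm n (c ∘ suc) ∘ toℕ)) ⟩
      -1ℤ * alternatingSum n (c ∘ suc)
        ≡⟨ -1*i≡-i _ ⟩
      - alternatingSum n (c ∘ suc) ∎)
      where open ≡-Reasoning

    alternatingSum-Δ : ∀ q n → alternatingSum n (f m q n) ≡ + (m ^ suc n)
    alternatingSum-Δ q zero = begin
      alternatingSum 0 (f m q 0)    ≡⟨ +-identityʳ (1ℤ * (1ℤ * + f m q 0 0)) ⟩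
      1ℤ * (1ℤ * + f m q 0 0)       ≡⟨ trans (*-identityˡ _) (*-identityˡ _) ⟩
      + f m q 0 0                   ≡⟨ cong +_ (trans (faceCount-point-vertices m) (sym (ℕ.*-identityʳ m))) ⟩
      + (m ℕ.* 1)                   ∎
      where open ≡-Reasoning
    alternatingSum-Δ q (suc n) = begin
      alternatingSum (suc n) (f m q (suc n))
        ≡⟨ alternatingSum-linear (suc n) q (faceCount-join-point (Δ m q n) q) ⟩
      alternatingSum (suc n) (f m q n) + + q * alternatingSum (suc n) (augmentedFaceCount (Δ m q n))
        ≡⟨ cong₂ (λ x y → x + + q * y) (alternatingSum-suc-of-top≡0 n (f m q n) (f-vanishes m q (ℕ.n<1+n n)))
                                        (alternatingSum-suc-shift n (augmentedFaceCount (Δ m q n))) ⟩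
      + m * alternatingSum n (f m q n) + + q * (M * 1ℤ - alternatingSum n (f m q n))
        ≡⟨ cong (λ x → + m * x + + q * (M * 1ℤ - x)) (alternatingSum-Δ q n) ⟩
      + m * M + + q * (M * 1ℤ - M)
        ≡⟨ secondTermVanishes (+ m) M (+ q) ⟩
      + m * M
        ≡⟨ sym (pos-* m (m ^ suc n)) ⟩
      + (m ^ suc (suc n)) ∎
      where
      open ≡-Reasoning
      M : ℤ
      M = + (m ^ suc n)
      secondTermVanishes : ∀ a x b → a * x + b * (x * 1ℤ - x) ≡ a * x
      secondTermVanishes = solve-∀

open AlternatingSums

-- The identity holds for all m and q.
corollary5p11 : (m : ℕ) → m ≥ 1 → (q : ℕ) → q ≥ 1 → (n : ℕ) →
    sumTo n (λ k → ((- (+ 1)) ℤ.^ k) ℤ.* ((+ (m ^ (n ∸ k))) ℤ.* (+ f m q n k)))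
    ≡ + (m ^ suc n)
corollary5p11 m _ q _ n = trans (sumTo-∑ n (alternatingTerm m n (f m q n))) (alternatingSum-Δ m q n)
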